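{- Let $K$ be a valued field, $d \geq 1$, and $X \subseteq K^d$. If $X$ is closed under 3-element convex combinations (i.e.\ whenever $x,y,z \in X$ and $\alpha,\beta,\gamma \in \mathcal{O}$ with $\alpha+\beta+\gamma = 1$, then $\alpha x + \beta y + \gamma z \in X$), then $X$ is convex.
   Context: $K$ is a field with a valuation $\nu$ and valuation ring $\mathcal{O} = \{x:\nu(x)\ge0\}$. A set $X \subseteq K^d$ is convex if for every $n\ge1$, $x_1,\ldots,x_n \in X$ and $\alpha_1,\ldots,\alpha_n \in \mathcal{O}$ with $\sum\alpha_i = 1$, we have $\sum\alpha_i x_i \in X$. -}

module Defs where

open import Level using (Level; _⊔_) renaming (suc to lsuc)
open import Data.Nat using (ℕ; zero; suc) renaming (_≤_ to _≤ℕ_)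
open import Data.Fin using (Fin; zero; suc)
open import Data.Maybe using (Maybe; just; nothing)
open import Data.Product using (_×_; ∃)
open import Data.Sum using (_⊎_)
open import Data.Empty.Polymorphic using (⊥)
open import Data.Unit.Polymorphic using (⊤)
open import Relation.Nullary using (¬_)
open import Relation.Binary.PropositionalEquality using (_≡_)
open import Algebra.Bundles using (CommutativeRing; AbelianGroup)
open import Relation.Binary.Structures using (IsTotalOrder)

record Field c ℓ : Set (lsuc (c ⊔ ℓ)) where
  field
    commutativeRing : CommutativeRing c ℓ
  open CommutativeRing commutativeRing public
  field
    1≉0     : ¬ (1# ≈ 0#)
    inverse : ∀ x → ¬ (x ≈ 0#) → ∃ λ y → (x * y) ≈ 1#

record OrderedAbelianGroup a ℓ₁ ℓ₂ : Set (lsuc (a ⊔ ℓ₁ ⊔ ℓ₂)) where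
  field
    abelianGroup : AbelianGroup a ℓ₁
  open AbelianGroup abelianGroup public
  field
    _≤_         : Carrier → Carrier → Set ℓ₂
    isTotalOrder : IsTotalOrder _≈_ _≤_
    ≤-translate : ∀ {x y} z → x ≤ y → (x ∙ z) ≤ (y ∙ z)

  -- Γ ∪ {∞}, with ∞ represented by nothing.
  Γ∞ : Set a
  Γ∞ = Maybe Carrier

  _≈∞_ : Γ∞ → Γ∞ → Set ℓ₁
  just x  ≈∞ just y  = x ≈ y
  nothing ≈∞ nothing = ⊤
  _       ≈∞ _       = ⊥

  _≤∞_ : Γ∞ → Γ∞ → Set ℓ₂
  just x  ≤∞ just y  = x ≤ y
  _       ≤∞ nothing = ⊤
  nothing ≤∞ just _  = ⊥

  _+∞_ : Γ∞ → Γ∞ → Γ∞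
  just x +∞ just y = just (x ∙ y)
  _      +∞ _      = nothing

record Valuation {c ℓ} (K : Field c ℓ) a ℓ₁ ℓ₂ : Set (lsuc (c ⊔ ℓ ⊔ a ⊔ ℓ₁ ⊔ ℓ₂)) where
  open Field K using (Carrier; _≈_; _+_; _*_; 0#; 1#)
  field
    Γ : OrderedAbelianGroup a ℓ₁ ℓ₂
  open OrderedAbelianGroup Γ using (Γ∞; _≈∞_; _≤∞_; _+∞_)
  field
    ν      : Carrier → Γ∞
    ν-cong : ∀ {x y} → x ≈ y → ν x ≈∞ ν y
    ν-∞⇒0  : ∀ x → ν x ≡ nothing → x ≈ 0#
    ν-0    : ν 0# ≡ nothing
    ν-*    : ∀ x y → ν (x * y) ≈∞ (ν x +∞ ν y)
    ν-+    : ∀ x y → (ν x ≤∞ ν (x + y)) ⊎ (ν y ≤∞ ν (x + y))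
    -- the last axiom is ν(x+y) ≥ min(ν x, ν y)

  𝒪 : Carrier → Set ℓ₂
  𝒪 x = just (OrderedAbelianGroup.ε Γ) ≤∞ ν x

module _ {c ℓ} (K : Field c ℓ) where
  open Field K using (Carrier; _≈_; _+_; _*_; 0#; 1#)

  ∑ : ∀ {n} → (Fin n → Carrier) → Carrier
  ∑ {zero}  f = 0#
  ∑ {suc n} f = f zero + ∑ (λ i → f (suc i))

  -- K^d as functions Fin d → K; vectors x, y are equal iff pointwise ≈.
  Kᵈ : ℕ → Set c
  Kᵈ d = Fin d → Carrier

  combination : ∀ {n d} → (Fin n → Carrier) → (Fin n → Kᵈ d) → Kᵈ d
  combination α x j = ∑ (λ i → α i * x i j)

  -- A subset X ⊆ K^d is a predicate; it must respect equality of vectors.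
  RespectsEq : ∀ {d p} → (Kᵈ d → Set p) → Set (c ⊔ ℓ ⊔ p)
  RespectsEq {d} X = ∀ {x y : Kᵈ d} → (∀ j → x j ≈ y j) → X x → X y

module _ {c ℓ a ℓ₁ ℓ₂} {K : Field c ℓ} (V : Valuation K a ℓ₁ ℓ₂) where
  open Field K using (Carrier; _≈_; _+_; _*_; 0#; 1#)
  open Valuation V

  IsConvex : ∀ {d p} → (Kᵈ K d → Set p) → Set (c ⊔ ℓ ⊔ ℓ₂ ⊔ p)
  IsConvex {d} X = ∀ (n : ℕ) → 1 ≤ℕ n →
    (x : Fin n → Kᵈ K d) → (α : Fin n → Carrier) →
    (∀ i → X (x i)) → (∀ i → 𝒪 (α i)) → ∑ K α ≈ 1# →
    X (combination K α x)

  Closed3 : ∀ {d p} → (Kᵈ K d → Set p) → Set (c ⊔ ℓ ⊔ ℓ₂ ⊔ p)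
  Closed3 {d} X = ∀ (x y z : Kᵈ K d) (α β γ : Carrier) →
    X x → X y → X z → 𝒪 α → 𝒪 β → 𝒪 γ → (α + β + γ) ≈ 1# →
    X (λ j → α * x j + β * y j + γ * z j)

-- A combination of n + 3 points is
-- rewritten as one of n + 2 points: the first three points are merged
-- into z = α₀ x₀ + α₁ x₁ + (α₂ + S) x₂, where S = α₃ + … + αₙ₊₂, and then
--   ∑ αᵢ xᵢ = 1·z + (−S)·x₂ + α₃ x₃ + … + αₙ₊₂ xₙ₊₂,
-- whose coefficients 1, −S, α₃, … again lie in 𝒪 and sum to 1.
-- Combinations of one or two points are three-point combinations in which
-- some coefficients are 0.
module Submission where

open import Defs
open import Level using (_⊔_)
open import Data.Nat using (zero; suc)
open import Data.Fin using (Fin; zero; suc)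
open import Data.Maybe using (just; nothing)
open import Data.Sum using (inj₁; inj₂)
open import Data.Unit.Polymorphic using (tt)
open import Data.Vec.Functional using ([]; _∷_)
open import Relation.Binary.Bundles using (Poset)
open import Relation.Binary.Structures using (IsTotalOrder)
open import Relation.Nullary using (contradiction)
import Algebra.Properties.Group as GroupProperties
import Algebra.Properties.Ring as RingProperties
import Relation.Binary.Reasoning.PartialOrder as PosetReasoning
import Relation.Binary.Reasoning.Setoid as SetoidReasoning

All-∷ : ∀ {a p} {A : Set a} (P : A → Set p) {n} {x : A} {xs : Fin n → A} →
        P x → (∀ i → P (xs i)) → ∀ i → P ((x ∷ xs) i)
All-∷ P px pxs zero    = px
All-∷ P px pxs (suc i) = pxs i

module OrderedAbelianGroupProperties {a ℓ₁ ℓ₂} (Γ : OrderedAbelianGroup a ℓ₁ ℓ₂) where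
  open OrderedAbelianGroup Γ
  open IsTotalOrder isTotalOrder using (isPartialOrder; total)
    renaming (trans to ≤-trans; reflexive to ≤-reflexive)
  open GroupProperties group using (identityˡ-unique)

  poset : Poset a ℓ₁ ℓ₂
  poset = record { isPartialOrder = isPartialOrder }

  open PosetReasoning poset

  ε≤x⇒ε≤y⇒ε≤x∙y : ∀ {x y} → ε ≤ x → ε ≤ y → ε ≤ (x ∙ y)
  ε≤x⇒ε≤y⇒ε≤x∙y {x} {y} ε≤x ε≤y = begin
    ε      ≤⟨ ε≤y ⟩
    y      ≈⟨ identityˡ y ⟨
    ε ∙ y  ≤⟨ ≤-translate y ε≤x ⟩
    x ∙ y  ∎

  ε≤x∙x⇒ε≤x : ∀ {x} → ε ≤ (x ∙ x) → ε ≤ x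
  ε≤x∙x⇒ε≤x {x} ε≤x∙x with total ε x
  ... | inj₁ ε≤x = ε≤x
  ... | inj₂ x≤ε = begin
    ε      ≤⟨ ε≤x∙x ⟩
    x ∙ x  ≤⟨ ≤-translate x x≤ε ⟩
    ε ∙ x  ≈⟨ identityˡ x ⟩
    x      ∎

  x∙x≈x⇒ε≤x : ∀ {x} → x ∙ x ≈ x → ε ≤ x
  x∙x≈x⇒ε≤x {x} x∙x≈x = ≤-reflexive (sym (identityˡ-unique x x x∙x≈x))

  ≈∞-sym : ∀ u v → u ≈∞ v → v ≈∞ u
  ≈∞-sym (just x) (just y) x≈y = sym x≈y
  ≈∞-sym nothing  nothing  _   = tt

  ε≤∞-trans : ∀ u v → just ε ≤∞ u → u ≤∞ v → just ε ≤∞ v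
  ε≤∞-trans (just x) (just y) ε≤x x≤y = ≤-trans ε≤x x≤y
  ε≤∞-trans _        nothing  _   _   = tt
  ε≤∞-trans nothing  (just y) _   ()

  ε≤∞-respʳ-≈∞ : ∀ u v → just ε ≤∞ u → u ≈∞ v → just ε ≤∞ v
  ε≤∞-respʳ-≈∞ (just x) (just y) ε≤x x≈y = ≤-trans ε≤x (≤-reflexive x≈y)
  ε≤∞-respʳ-≈∞ _        nothing  _   _   = tt
  ε≤∞-respʳ-≈∞ nothing  (just y) _   ()

  ε≤∞-+∞ : ∀ u v → just ε ≤∞ u → just ε ≤∞ v → just ε ≤∞ (u +∞ v)
  ε≤∞-+∞ (just x) (just y) ε≤x ε≤y = ε≤x⇒ε≤y⇒ε≤x∙y ε≤x ε≤y
  ε≤∞-+∞ (just x) nothing  _   _   = tt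
  ε≤∞-+∞ nothing  _        _   _   = tt

  ε≤∞u+∞u⇒ε≤∞u : ∀ u → just ε ≤∞ (u +∞ u) → just ε ≤∞ u
  ε≤∞u+∞u⇒ε≤∞u (just x) = ε≤x∙x⇒ε≤x
  ε≤∞u+∞u⇒ε≤∞u nothing  = _

module ValuationRingProperties {c ℓ a ℓ₁ ℓ₂} {K : Field c ℓ} (V : Valuation K a ℓ₁ ℓ₂) where
  open Field K hiding (zero)
  open Valuation V
  module Γ = OrderedAbelianGroup Γ
  open Γ using (_+∞_)
  open OrderedAbelianGroupProperties Γ
  open RingProperties ring using (-1*x≈-x)
  open GroupProperties +-group using (⁻¹-involutive)

  𝒪-cong : ∀ {x y} → x ≈ y → 𝒪 x → 𝒪 y
  𝒪-cong {x} {y} x≈y 𝒪x = ε≤∞-respʳ-≈∞ (ν x) (ν y) 𝒪x (ν-cong x≈y)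

  𝒪-0# : 𝒪 0#
  𝒪-0# rewrite ν-0 = tt

  𝒪-1# : 𝒪 1#
  𝒪-1# with ν 1# in ν1≡ | ν (1# * 1#) | ν-* 1# 1# | ν-cong (*-identityˡ 1#)
  ... | nothing | _       | _        | _    = contradiction (ν-∞⇒0 1# ν1≡) 1≉0
  ... | just h  | nothing | ()       | _
  ... | just h  | just g  | g≈h∙h    | g≈h  = x∙x≈x⇒ε≤x (Γ.trans (Γ.sym g≈h∙h) g≈h)

  𝒪-+ : ∀ {x y} → 𝒪 x → 𝒪 y → 𝒪 (x + y)
  𝒪-+ {x} {y} 𝒪x 𝒪y with ν-+ x y
  ... | inj₁ νx≤ = ε≤∞-trans (ν x) (ν (x + y)) 𝒪x νx≤
  ... | inj₂ νy≤ = ε≤∞-trans (ν y) (ν (x + y)) 𝒪y νy≤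

  𝒪-* : ∀ {x y} → 𝒪 x → 𝒪 y → 𝒪 (x * y)
  𝒪-* {x} {y} 𝒪x 𝒪y = ε≤∞-respʳ-≈∞ (ν x +∞ ν y) (ν (x * y))
    (ε≤∞-+∞ (ν x) (ν y) 𝒪x 𝒪y) (≈∞-sym (ν (x * y)) (ν x +∞ ν y) (ν-* x y))

  𝒪-*-square⇒𝒪 : ∀ {x} → 𝒪 (x * x) → 𝒪 x
  𝒪-*-square⇒𝒪 {x} 𝒪x² =
    ε≤∞u+∞u⇒ε≤∞u (ν x) (ε≤∞-respʳ-≈∞ (ν (x * x)) (ν x +∞ ν x) 𝒪x² (ν-* x x))

  𝒪-‿ : ∀ {x} → 𝒪 x → 𝒪 (- x)
  𝒪-‿ {x} 𝒪x = 𝒪-cong (-1*x≈-x x) (𝒪-* 𝒪-‿1# 𝒪x)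
    where
    𝒪-‿1# : 𝒪 (- 1#)
    𝒪-‿1# = 𝒪-*-square⇒𝒪
      (𝒪-cong (sym (trans (-1*x≈-x (- 1#)) (⁻¹-involutive 1#))) 𝒪-1#)

  𝒪-∑ : ∀ {n} (α : Fin n → Carrier) → (∀ i → 𝒪 (α i)) → 𝒪 (∑ K α)
  𝒪-∑ {zero}  α 𝒪α = 𝒪-0#
  𝒪-∑ {suc n} α 𝒪α = 𝒪-+ (𝒪α zero) (𝒪-∑ (λ i → α (suc i)) (λ i → 𝒪α (suc i)))

open import Data.Nat using (ℕ; _≤_)

module Convexity {c ℓ a ℓ₁ ℓ₂ d p} {K : Field c ℓ} (V : Valuation K a ℓ₁ ℓ₂)
                 (X : Kᵈ K d → Set p) (X-resp : RespectsEq K X) where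
  open Field K hiding (zero)
  open Valuation V using (𝒪)
  open ValuationRingProperties V
  open GroupProperties +-group using (\\-leftDividesˡ)
  open RingProperties ring using (-‿distribˡ-*)
  open SetoidReasoning setoid

  ClosedUnder : ℕ → Set (c ⊔ ℓ ⊔ ℓ₂ ⊔ p)
  ClosedUnder n = (x : Fin n → Kᵈ K d) (α : Fin n → Carrier) →
    (∀ i → X (x i)) → (∀ i → 𝒪 (α i)) → ∑ K α ≈ 1# → X (combination K α x)

  Closed3⇒ClosedUnder3 : Closed3 V X → ClosedUnder 3
  Closed3⇒ClosedUnder3 closed3 x α Xx 𝒪α ∑α≈1 = X-resp (λ j → +-reassoc _ _ _)
    (closed3 (x zero) (x (suc zero)) (x (suc (suc zero)))
             (α zero) (α (suc zero)) (α (suc (suc zero)))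
             (Xx zero) (Xx (suc zero)) (Xx (suc (suc zero)))
             (𝒪α zero) (𝒪α (suc zero)) (𝒪α (suc (suc zero)))
             (trans (+-reassoc _ _ _) ∑α≈1))
    where
    +-reassoc : ∀ u v w → u + v + w ≈ u + (v + (w + 0#))
    +-reassoc u v w = trans (+-assoc u v w) (+-congˡ (+-congˡ (sym (+-identityʳ w))))

  ClosedUnder-suc⇒ClosedUnder : ∀ {n} → ClosedUnder (suc (suc n)) → ClosedUnder (suc n)
  ClosedUnder-suc⇒ClosedUnder closed x α Xx 𝒪α ∑α≈1 =
    X-resp (λ j → 0#*u+v≈v (x zero j) (combination K α x j))
      (closed (x zero ∷ x) (0# ∷ α) (All-∷ X (Xx zero) Xx) (All-∷ 𝒪 𝒪-0# 𝒪α)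
        (trans (+-identityˡ (∑ K α)) ∑α≈1))
    where
    0#*u+v≈v : ∀ u v → 0# * u + v ≈ v
    0#*u+v≈v u v = trans (+-congʳ (zeroˡ u)) (+-identityˡ v)

  merged-combination-≈ : ∀ u v a s y r →
    1# * (u + (v + ((a + s) * y + 0#))) + (- s * y + r) ≈ u + (v + (a * y + r))
  merged-combination-≈ u v a s y r = begin
    1# * (u + (v + ((a + s) * y + 0#))) + (- s * y + r)
      ≈⟨ +-cong (*-identityˡ _) (+-congʳ (sym (-‿distribˡ-* s y))) ⟩
    (u + (v + ((a + s) * y + 0#))) + (- (s * y) + r)
      ≈⟨ +-congʳ (+-congˡ (+-congˡ (trans (+-identityʳ _) (distribʳ y a s)))) ⟩
    (u + (v + (a * y + s * y))) + (- (s * y) + r)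
      ≈⟨ trans (+-assoc u _ _) (+-congˡ (+-assoc v _ _)) ⟩
    u + (v + ((a * y + s * y) + (- (s * y) + r)))
      ≈⟨ +-congˡ (+-congˡ (+-assoc (a * y) _ _)) ⟩
    u + (v + (a * y + (s * y + (- (s * y) + r))))
      ≈⟨ +-congˡ (+-congˡ (+-congˡ (\\-leftDividesˡ (s * y) r))) ⟩
    u + (v + (a * y + r))
      ∎

  merge-first-three : ∀ {n} → ClosedUnder 3 →
    ClosedUnder (suc (suc n)) → ClosedUnder (suc (suc (suc n)))
  merge-first-three {n} closed3 closed x α Xx 𝒪α ∑α≈1 =
    X-resp (λ j → merged-combination-≈ (α₀ * x₀ j) (α₁ * x₁ j) α₂ S (x₂ j)
                                       (combination K αs xs j))
      (closed (z ∷ x₂ ∷ xs) (1# ∷ - S ∷ αs)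
        (All-∷ X Xz (All-∷ X (Xx (suc (suc zero))) (λ i → Xx (suc (suc (suc i))))))
        (All-∷ 𝒪 𝒪-1# (All-∷ 𝒪 (𝒪-‿ 𝒪S) (λ i → 𝒪α (suc (suc (suc i))))))
        (trans (+-congˡ (-‿inverseˡ S)) (+-identityʳ 1#)))
    where
    x₀ x₁ x₂ : Kᵈ K d
    x₀ = x zero
    x₁ = x (suc zero)
    x₂ = x (suc (suc zero))
    xs : Fin n → Kᵈ K d
    xs i = x (suc (suc (suc i)))
    α₀ α₁ α₂ : Carrier
    α₀ = α zero
    α₁ = α (suc zero)
    α₂ = α (suc (suc zero))
    αs : Fin n → Carrier
    αs i = α (suc (suc (suc i)))
    S : Carrier
    S = ∑ K αs
    𝒪S : 𝒪 S
    𝒪S = 𝒪-∑ αs (λ i → 𝒪α (suc (suc (suc i))))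
    z : Kᵈ K d
    z = combination K (α₀ ∷ α₁ ∷ (α₂ + S) ∷ []) (x₀ ∷ x₁ ∷ x₂ ∷ [])
    Xz : X z
    Xz = closed3 (x₀ ∷ x₁ ∷ x₂ ∷ []) (α₀ ∷ α₁ ∷ (α₂ + S) ∷ [])
      (λ { zero             → Xx zero
         ; (suc zero)       → Xx (suc zero)
         ; (suc (suc zero)) → Xx (suc (suc zero)) })
      (λ { zero             → 𝒪α zero
         ; (suc zero)       → 𝒪α (suc zero)
         ; (suc (suc zero)) → 𝒪-+ (𝒪α (suc (suc zero))) 𝒪S })
      (trans (+-congˡ (+-congˡ (+-identityʳ (α₂ + S)))) ∑α≈1)

  Closed3⇒ClosedUnder-3+ : Closed3 V X → ∀ n → ClosedUnder (suc (suc (suc n)))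
  Closed3⇒ClosedUnder-3+ closed3 zero    = Closed3⇒ClosedUnder3 closed3
  Closed3⇒ClosedUnder-3+ closed3 (suc n) =
    merge-first-three (Closed3⇒ClosedUnder3 closed3) (Closed3⇒ClosedUnder-3+ closed3 n)

  Closed3⇒ClosedUnder-suc : Closed3 V X → ∀ n → ClosedUnder (suc n)
  Closed3⇒ClosedUnder-suc closed3 n =
    ClosedUnder-suc⇒ClosedUnder (ClosedUnder-suc⇒ClosedUnder (Closed3⇒ClosedUnder-3+ closed3 n))

proposition2p6 : ∀ {c ℓ a ℓ₁ ℓ₂ p} {K : Field c ℓ} (V : Valuation K a ℓ₁ ℓ₂)
    (d : ℕ) → 1 ≤ d → (X : Kᵈ K d → Set p) → RespectsEq K X →
    Closed3 V X → IsConvex V X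
proposition2p6 V d _ X X-resp closed3 (suc n) _ =
  Convexity.Closed3⇒ClosedUnder-suc V X X-resp closed3 n
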